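{- For all finite multisets of formulas $\Phi,\Psi$, the proof-search procedure in $G^{+}_{Grz}$ started at the sequent $\emptyset|\Phi\Rightarrow\Psi$ terminates, i.e. produces a finite tree.
   Context: Formulas are built from propositional variables and $\bot$ by $\neg,\wedge,\vee,\Box$; $\alpha\to\beta:=\neg\alpha\vee\beta$; $\Box\Gamma$ is the multiset $\Gamma$ with each element prefixed by $\Box$; $D(\alpha):=\Box(\alpha\to\Box\alpha)$. Sequents of $G^{+}_{Grz}$ have the form $\Box\Sigma|\Gamma\Rightarrow\Delta$ with $\Sigma,\Gamma,\Delta$ finite multisets. Axioms: $\Box\Sigma|\Gamma,p\Rightarrow p,\Delta$ ($p$ a propositional variable) and $\Box\Sigma|\Gamma,\bot\Rightarrow\Delta$. Propositional rules (with $\Box\Sigma$ unchanged): $\wedge$-l, $\vee$-r, $\neg$-r, $\neg$-l (one premise: $\Box\Sigma|\Gamma,\alpha,\beta\Rightarrow\Delta$ / $\Box\Sigma|\Gamma\Rightarrow\alpha,\beta,\Delta$ / $\Box\Sigma|\Gamma,\alpha\Rightarrow\Delta$ / $\Box\Sigma|\Gamma\Rightarrow\alpha,\Delta$ with conclusions $\Box\Sigma|\Gamma,\alpha\wedge\beta\Rightarrow\Delta$ / $\Box\Sigma|\Gamma\Rightarrow\alpha\vee\beta,\Delta$ / $\Box\Sigma|\Gamma\Rightarrow\neg\alpha,\Delta$ / $\Box\Sigma|\Gamma,\neg\alpha\Rightarrow\Delta$), and $\wedge$-r (premises $\Box\Sigma|\Gamma\Rightarrow\alpha,\Delta$, $\Box\Sigma|\Gamma\Rightarrow\beta,\Delta$,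 conclusion $\Box\Sigma|\Gamma\Rightarrow\alpha\wedge\beta,\Delta$), $\vee$-l (premises $\Box\Sigma|\Gamma,\alpha\Rightarrow\Delta$, $\Box\Sigma|\Gamma,\beta\Rightarrow\Delta$, conclusion $\Box\Sigma|\Gamma,\alpha\vee\beta\Rightarrow\Delta$). Modal rules: $\Box^{+}_{T}$: from $\Box\alpha,\Box\Sigma|\Gamma,\alpha\Rightarrow\Delta$ infer $\Box\Sigma|\Gamma,\Box\alpha\Rightarrow\Delta$; $\Box^{+}_{Grz1}$: from $\Box\Gamma|\emptyset\Rightarrow\alpha$ infer $\Box\Gamma|\Pi\Rightarrow\Box\alpha,\Delta$ provided $D(\alpha)\in\Box\Gamma$; $\Box^{+}_{Grz2}$: from $\Box\Gamma,D(\alpha)|\Gamma\Rightarrow\alpha$ infer $\Box\Gamma|\Pi\Rightarrow\Box\alpha,\Delta$ provided $D(\alpha)\notin\Box\Gamma$; in both, $\Pi$ contains only propositional variables and $\Delta$ only propositional variables and boxed formulas. The invertible rules are the propositional rules and $\Box^{+}_{T}$. A sequent is critical if no invertible rule applies backwards; critical sequents have the form $\Box\Gamma|\Pi\Rightarrow\Box\Delta,\Lambda$ with $\Pi,\Lambda$ atomic. The closure of a sequent is the set of critical sequents in the smallest set containing it and closed under backward applications of the invertible rules. Proof-search procedure: create a root labelled with the given sequent; for a node labelled with a non-critical sequent, create one child per element of its closure; for a node labelled with a critical sequent $\Box\Gamma|\Pi\Rightarrow\Box\Delta,\Lambda$: if $\Pi\cap\Lambda\neq\emptyset$ or $\bot\in\Pi$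 or $\Gamma\cap\Delta\neq\emptyset$ it is a provable leaf; otherwise if $\Delta=\emptyset$ it is an unprovable leaf; otherwise create for each $\Box\alpha\in\Box\Delta$ a child labelled with the premise of the applicable modal rule with principal formula $\Box\alpha$, namely $\Box\Gamma|\emptyset\Rightarrow\alpha$ if $D(\alpha)\in\Box\Gamma$ and $\Box\Gamma,D(\alpha)|\Gamma\Rightarrow\alpha$ if $D(\alpha)\notin\Box\Gamma$. (Formulas stored in the first multiset may be treated without duplicates, i.e. as a set.) -}

module Defs where

open import Data.Nat using (ℕ)
open import Data.List using (List; []; _∷_)
open import Data.List.Membership.Propositional using (_∈_)
open import Data.Product using (Σ; ∃; _×_)
open import Data.Sum using (_⊎_)
open import Relation.Nullary using (¬_)
open import Relation.Binary.Construct.Closure.ReflexiveTransitive using (Star)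

data Fm : Set where
  var  : ℕ → Fm
  bot  : Fm
  neg  : Fm → Fm
  _and_ : Fm → Fm → Fm
  _or_  : Fm → Fm → Fm
  box  : Fm → Fm

_imp_ : Fm → Fm → Fm
a imp b = neg a or b

-- D(α) = □(α → □α); we store the unboxed body α → □α
Dbody : Fm → Fm
Dbody a = a imp box a

-- Sequent □Σ | Γ ⇒ Δ. Finite multisets are represented by lists
-- (order irrelevant); 'boxed' stores Σ (the formulas under the boxes).
record Seq : Set where
  constructor ⟨_∣_⇒_⟩
  field
    boxed : List Fm
    ant   : List Fm
    suc   : List Fm
open Seq public

data Pick (x : Fm) : List Fm → List Fm → Set where
  here  : ∀ {xs} → Pick x (x ∷ xs) xs
  there : ∀ {y xs ys} → Pick x xs ys → Pick x (y ∷ xs) (y ∷ ys)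

-- Step s s' : s' is a premise of an invertible rule (propositional rules
-- or □T) whose conclusion is s, i.e. a backward application to s.
data Step : Seq → Seq → Set where
  ∧l  : ∀ {S G G' D a b} → Pick (a and b) G G' → Step ⟨ S ∣ G ⇒ D ⟩ ⟨ S ∣ a ∷ b ∷ G' ⇒ D ⟩
  ∨r  : ∀ {S G D D' a b} → Pick (a or b) D D' → Step ⟨ S ∣ G ⇒ D ⟩ ⟨ S ∣ G ⇒ a ∷ b ∷ D' ⟩
  ¬r  : ∀ {S G D D' a} → Pick (neg a) D D' → Step ⟨ S ∣ G ⇒ D ⟩ ⟨ S ∣ a ∷ G ⇒ D' ⟩
  ¬l  : ∀ {S G G' D a} → Pick (neg a) G G' → Step ⟨ S ∣ G ⇒ D ⟩ ⟨ S ∣ G' ⇒ a ∷ D ⟩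
  ∧r₁ : ∀ {S G D D' a b} → Pick (a and b) D D' → Step ⟨ S ∣ G ⇒ D ⟩ ⟨ S ∣ G ⇒ a ∷ D' ⟩
  ∧r₂ : ∀ {S G D D' a b} → Pick (a and b) D D' → Step ⟨ S ∣ G ⇒ D ⟩ ⟨ S ∣ G ⇒ b ∷ D' ⟩
  ∨l₁ : ∀ {S G G' D a b} → Pick (a or b) G G' → Step ⟨ S ∣ G ⇒ D ⟩ ⟨ S ∣ a ∷ G' ⇒ D ⟩
  ∨l₂ : ∀ {S G G' D a b} → Pick (a or b) G G' → Step ⟨ S ∣ G ⇒ D ⟩ ⟨ S ∣ b ∷ G' ⇒ D ⟩
  □T  : ∀ {S G G' D a} → Pick (box a) G G' → Step ⟨ S ∣ G ⇒ D ⟩ ⟨ a ∷ S ∣ a ∷ G' ⇒ D ⟩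

Critical : Seq → Set
Critical s = ∀ s' → ¬ Step s s'

InClosure : Seq → Seq → Set
InClosure s s' = Star Step s s' × Critical s'

Closed : Seq → Set
Closed s = (∃ λ x → x ∈ ant s × x ∈ suc s)
         ⊎ (bot ∈ ant s)
         ⊎ (∃ λ a → a ∈ boxed s × box a ∈ suc s)

data ModalPremise (S : List Fm) (a : Fm) : Seq → Set where
  grz1 : Dbody a ∈ S → ModalPremise S a ⟨ S ∣ [] ⇒ a ∷ [] ⟩
  grz2 : ¬ (Dbody a ∈ S) → ModalPremise S a ⟨ Dbody a ∷ S ∣ S ⇒ a ∷ [] ⟩

Child : Seq → Seq → Set
Child s s' =
    (¬ Critical s × InClosure s s')
  ⊎ (Critical s × ¬ Closed s × ∃ λ a → box a ∈ suc s × ModalPremise (boxed s) a s')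

-- The proof-search tree rooted at s is finite: finitely many children
-- (covered by a list), each of which roots a finite tree.
data FinTree (s : Seq) : Set where
  node : (cs : List Seq)
       → (∀ s' → Child s s' → s' ∈ cs)
       → (∀ s' → Child s s' → FinTree s')
       → FinTree s

module Submission where

-- Within a node, the invertible rules are finitely branching and strictly decrease the total
-- size of Γ and Δ, so every closure is finite. Across a modal rule the pair
--   (number of formulas of a fixed finite universe not yet in □Σ, size of the largest α with □α in Δ)
-- decreases lexicographically: □Σ never shrinks, Grz2 adds the new formula D(α) to it, and
-- after Grz1 the succedent holds only subformulas of α. The universe consists of the
-- subformulas of the root formulas and of D(β) for β among those subformulas; it contains
-- every formula occurring in the search.

open import Defs renaming (suc to succedent)
open import Data.List using (List; []; _∷_; _++_; map; concatMap; [_])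
open import Data.List.Properties using (++-assoc; ∷-injectiveˡ; ≡-dec)
open import Data.List.Membership.Propositional using (_∈_; _∉_; lose)
open import Data.List.Membership.Propositional.Properties using (∈-++⁺ˡ; ∈-++⁺ʳ; ∈-map⁺; ∈-concatMap⁺)
open import Data.List.Relation.Binary.Subset.Propositional using (_⊆_)
open import Data.List.Relation.Unary.Any using (here; there)
open import Data.Nat using (ℕ; zero; suc; _+_; _≤_; _<_; _⊔_; z≤n; s≤s)
import Data.Nat as ℕ
open import Data.Nat.Properties
  using (≤-refl; ≤-reflexive; ≤-trans; <-≤-trans; ≤-pred; n≮0; m≤n⇒m≤1+n; m≤n⇒m<n∨m≡n; m≤m+n; m≤n+m;
         m+n≤o⇒m≤o; +-comm; m≤m⊔n; m≤n⊔m; ⊔-lub; +-commutativeSemigroup)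
open import Data.Nat.Induction using (<-wellFounded)
open import Data.Nat.Tactic.RingSolver using (solve-∀)
open import Data.Product using (∃-syntax; _×_; _,_)
open import Data.Product.Relation.Binary.Lex.Strict using (×-Lex; ×-wellFounded)
open import Data.Sum using (_⊎_; inj₁; inj₂)
open import Data.Empty using (⊥-elim)
open import Function using (_on_; _∘_)
open import Induction.WellFounded using (Acc; acc; WellFounded)
open import Relation.Nullary using (yes; no)
open import Relation.Nullary.Decidable using (map′)
open import Relation.Binary.Definitions using (DecidableEquality)
open import Relation.Binary.PropositionalEquality using (_≡_; refl; sym; cong; module ≡-Reasoning)
open import Relation.Binary.Construct.Closure.ReflexiveTransitive using (Star; ε; _◅_)
import Relation.Binary.Construct.On as On
open import Algebra.Properties.CommutativeSemigroup +-commutativeSemigroup using (x∙yz≈y∙xz)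

-- Postfix code: decoding is a stack machine, which gives a left inverse of `code`
-- and hence decidable equality without comparing every pair of constructors.
code : Fm → List ℕ
code (var n)   = [ 5 + n ]
code bot       = [ 0 ]
code (neg a)   = code a ++ [ 1 ]
code (a and b) = code a ++ code b ++ [ 2 ]
code (a or b)  = code a ++ code b ++ [ 3 ]
code (box a)   = code a ++ [ 4 ]

decode : List ℕ → List Fm → List Fm
decode []                  st           = st
decode (0 ∷ ts)            st           = decode ts (bot ∷ st)
decode (1 ∷ ts)            (a ∷ st)     = decode ts (neg a ∷ st)
decode (2 ∷ ts)            (b ∷ a ∷ st) = decode ts ((a and b) ∷ st)
decode (3 ∷ ts)            (b ∷ a ∷ st) = decode ts ((a or b) ∷ st)
decode (4 ∷ ts)            (a ∷ st)     = decode ts (box a ∷ st)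
decode (suc (suc (suc (suc (suc n)))) ∷ ts) st = decode ts (var n ∷ st)
decode (_ ∷ ts)            st           = decode ts st

decode-code : ∀ x ts st → decode (code x ++ ts) st ≡ decode ts (x ∷ st)
decode-code (var n)   ts st = refl
decode-code bot       ts st = refl
decode-code (neg a)   ts st
  rewrite ++-assoc (code a) [ 1 ] ts = decode-code a (1 ∷ ts) st
decode-code (a and b) ts st
  rewrite ++-assoc (code a) (code b ++ [ 2 ]) ts | ++-assoc (code b) [ 2 ] ts
        | decode-code a (code b ++ 2 ∷ ts) st = decode-code b (2 ∷ ts) (a ∷ st)
decode-code (a or b)  ts st
  rewrite ++-assoc (code a) (code b ++ [ 3 ]) ts | ++-assoc (code b) [ 3 ] ts
        | decode-code a (code b ++ 3 ∷ ts) st = decode-code b (3 ∷ ts) (a ∷ st)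
decode-code (box a)   ts st
  rewrite ++-assoc (code a) [ 4 ] ts = decode-code a (4 ∷ ts) st

code-injective : ∀ {x y} → code x ≡ code y → x ≡ y
code-injective {x} {y} eq = ∷-injectiveˡ (begin
  x ∷ []                 ≡⟨ sym (decode-code x [] []) ⟩
  decode (code x ++ []) [] ≡⟨ cong (λ c → decode (c ++ []) []) eq ⟩
  decode (code y ++ []) [] ≡⟨ decode-code y [] [] ⟩
  y ∷ []                 ∎)
  where open ≡-Reasoning

_≟_ : DecidableEquality Fm
x ≟ y = map′ code-injective (cong code) (≡-dec ℕ._≟_ (code x) (code y))

infix 4 _≼_
data _≼_ : Fm → Fm → Set where
  ≼-refl : ∀ {x} → x ≼ x
  ≼-neg  : ∀ {x a} → x ≼ a → x ≼ neg a
  ≼-andˡ : ∀ {x a b} → x ≼ a → x ≼ (a and b)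
  ≼-andʳ : ∀ {x a b} → x ≼ b → x ≼ (a and b)
  ≼-orˡ  : ∀ {x a b} → x ≼ a → x ≼ (a or b)
  ≼-orʳ  : ∀ {x a b} → x ≼ b → x ≼ (a or b)
  ≼-box  : ∀ {x a} → x ≼ a → x ≼ box a

≼-trans : ∀ {x y z} → x ≼ y → y ≼ z → x ≼ z
≼-trans p ≼-refl     = p
≼-trans p (≼-neg q)  = ≼-neg (≼-trans p q)
≼-trans p (≼-andˡ q) = ≼-andˡ (≼-trans p q)
≼-trans p (≼-andʳ q) = ≼-andʳ (≼-trans p q)
≼-trans p (≼-orˡ q)  = ≼-orˡ (≼-trans p q)
≼-trans p (≼-orʳ q)  = ≼-orʳ (≼-trans p q)
≼-trans p (≼-box q)  = ≼-box (≼-trans p q)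

box-≼-Dbody : ∀ {a b} → box a ≼ Dbody b → a ≼ b
box-≼-Dbody (≼-orˡ (≼-neg p))  = ≼-trans (≼-box ≼-refl) p
box-≼-Dbody (≼-orʳ ≼-refl)     = ≼-refl
box-≼-Dbody (≼-orʳ (≼-box p))  = ≼-trans (≼-box ≼-refl) p

size : Fm → ℕ
size (var _)   = 1
size bot       = 1
size (neg a)   = suc (size a)
size (a and b) = suc (size a + size b)
size (a or b)  = suc (size a + size b)
size (box a)   = suc (size a)

≼⇒size≤ : ∀ {x y} → x ≼ y → size x ≤ size y
≼⇒size≤ ≼-refl = ≤-refl
≼⇒size≤ (≼-neg p) = m≤n⇒m≤1+n (≼⇒size≤ p)
≼⇒size≤ {y = a and b} (≼-andˡ p) = m≤n⇒m≤1+n (≤-trans (≼⇒size≤ p) (m≤m+n (size a) (size b)))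
≼⇒size≤ {y = a and b} (≼-andʳ p) = m≤n⇒m≤1+n (≤-trans (≼⇒size≤ p) (m≤n+m (size b) (size a)))
≼⇒size≤ {y = a or b}  (≼-orˡ p)  = m≤n⇒m≤1+n (≤-trans (≼⇒size≤ p) (m≤m+n (size a) (size b)))
≼⇒size≤ {y = a or b}  (≼-orʳ p)  = m≤n⇒m≤1+n (≤-trans (≼⇒size≤ p) (m≤n+m (size b) (size a)))
≼⇒size≤ (≼-box p) = m≤n⇒m≤1+n (≼⇒size≤ p)

mutual
  subformulas : Fm → List Fm
  subformulas a = a ∷ properSubformulas a

  properSubformulas : Fm → List Fm
  properSubformulas (var _)   = []
  properSubformulas bot       = []
  properSubformulas (neg a)   = subformulas a
  properSubformulas (a and b) = subformulas a ++ subformulas b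
  properSubformulas (a or b)  = subformulas a ++ subformulas b
  properSubformulas (box a)   = subformulas a

≼⇒∈subformulas : ∀ {x y} → x ≼ y → x ∈ subformulas y
≼⇒∈subformulas ≼-refl     = here refl
≼⇒∈subformulas (≼-neg p)  = there (≼⇒∈subformulas p)
≼⇒∈subformulas (≼-andˡ p) = there (∈-++⁺ˡ (≼⇒∈subformulas p))
≼⇒∈subformulas {y = a and _} (≼-andʳ p) = there (∈-++⁺ʳ (subformulas a) (≼⇒∈subformulas p))
≼⇒∈subformulas (≼-orˡ p)  = there (∈-++⁺ˡ (≼⇒∈subformulas p))
≼⇒∈subformulas {y = a or _}  (≼-orʳ p)  = there (∈-++⁺ʳ (subformulas a) (≼⇒∈subformulas p))
≼⇒∈subformulas (≼-box p)  = there (≼⇒∈subformulas p)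

infix 4 _≼ₗ_
_≼ₗ_ : Fm → List Fm → Set
x ≼ₗ L = ∃[ y ] (y ∈ L × x ≼ y)

≼ₗ⇒∈ : ∀ {x L} → x ≼ₗ L → x ∈ concatMap subformulas L
≼ₗ⇒∈ (_ , y∈L , x≼y) = ∈-concatMap⁺ subformulas (lose y∈L (≼⇒∈subformulas x≼y))

Pick⇒∈ : ∀ {x G G'} → Pick x G G' → x ∈ G
Pick⇒∈ here      = here refl
Pick⇒∈ (there p) = there (Pick⇒∈ p)

Pick⇒⊆ : ∀ {x G G'} → Pick x G G' → G' ⊆ G
Pick⇒⊆ here      m         = there m
Pick⇒⊆ (there p) (here eq) = here eq
Pick⇒⊆ (there p) (there m) = there (Pick⇒⊆ p m)

picks : List Fm → List (Fm × List Fm)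
picks []       = []
picks (x ∷ xs) = (x , xs) ∷ map (λ (y , ys) → y , x ∷ ys) (picks xs)

Pick⇒∈picks : ∀ {x G G'} → Pick x G G' → (x , G') ∈ picks G
Pick⇒∈picks here                = here refl
Pick⇒∈picks (there {y = y} p) = there (∈-map⁺ (λ (z , zs) → z , y ∷ zs) (Pick⇒∈picks p))

weight : List Fm → ℕ
weight []      = 0
weight (x ∷ G) = size x + weight G

Pick-weight : ∀ {x G G'} → Pick x G G' → weight G ≡ size x + weight G'
Pick-weight here = refl
Pick-weight {x} (there {y = y} {ys = G'} p)
  rewrite Pick-weight p = x∙yz≈y∙xz (size y) (size x) (weight G')

leftPremises : List Fm → List Fm → Fm × List Fm → List Seq
leftPremises S D ((a and b) , G') = ⟨ S ∣ a ∷ b ∷ G' ⇒ D ⟩ ∷ []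
leftPremises S D ((a or b) , G')  = ⟨ S ∣ a ∷ G' ⇒ D ⟩ ∷ ⟨ S ∣ b ∷ G' ⇒ D ⟩ ∷ []
leftPremises S D (neg a , G')     = ⟨ S ∣ G' ⇒ a ∷ D ⟩ ∷ []
leftPremises S D (box a , G')     = ⟨ a ∷ S ∣ a ∷ G' ⇒ D ⟩ ∷ []
leftPremises S D _                = []

rightPremises : List Fm → List Fm → Fm × List Fm → List Seq
rightPremises S G ((a and b) , D') = ⟨ S ∣ G ⇒ a ∷ D' ⟩ ∷ ⟨ S ∣ G ⇒ b ∷ D' ⟩ ∷ []
rightPremises S G ((a or b) , D')  = ⟨ S ∣ G ⇒ a ∷ b ∷ D' ⟩ ∷ []
rightPremises S G (neg a , D')     = ⟨ S ∣ a ∷ G ⇒ D' ⟩ ∷ []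
rightPremises S G _                = []

invertiblePremises : Seq → List Seq
invertiblePremises ⟨ S ∣ G ⇒ D ⟩ =
  concatMap (leftPremises S D) (picks G) ++ concatMap (rightPremises S G) (picks D)

Step⇒∈invertiblePremises : ∀ {s s'} → Step s s' → s' ∈ invertiblePremises s
Step⇒∈invertiblePremises {⟨ S ∣ G ⇒ D ⟩} st = go st
  where
  left : ∀ {x G' s'} → Pick x G G' → s' ∈ leftPremises S D (x , G') →
         s' ∈ invertiblePremises ⟨ S ∣ G ⇒ D ⟩
  left p m = ∈-++⁺ˡ (∈-concatMap⁺ (leftPremises S D) (lose (Pick⇒∈picks p) m))
  right : ∀ {x D' s'} → Pick x D D' → s' ∈ rightPremises S G (x , D') →
          s' ∈ invertiblePremises ⟨ S ∣ G ⇒ D ⟩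
  right p m = ∈-++⁺ʳ (concatMap (leftPremises S D) (picks G))
                     (∈-concatMap⁺ (rightPremises S G) (lose (Pick⇒∈picks p) m))
  go : ∀ {s'} → Step ⟨ S ∣ G ⇒ D ⟩ s' → s' ∈ invertiblePremises ⟨ S ∣ G ⇒ D ⟩
  go (∧l p)  = left p (here refl)
  go (∨l₁ p) = left p (here refl)
  go (∨l₂ p) = left p (there (here refl))
  go (¬l p)  = left p (here refl)
  go (□T p)  = left p (here refl)
  go (∧r₁ p) = right p (here refl)
  go (∧r₂ p) = right p (there (here refl))
  go (∨r p)  = right p (here refl)
  go (¬r p)  = right p (here refl)

weightₛ : Seq → ℕ
weightₛ s = weight (ant s) + weight (succedent s)

Step⇒weight< : ∀ {s s'} → Step s s' → weightₛ s' < weightₛ s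
Step⇒weight< {⟨ S ∣ G ⇒ D ⟩} = go
  where
  exact₃ : ∀ a g d → suc (a + g + d) ≡ suc a + g + d
  exact₃ = solve-∀
  exact₄ : ∀ a b g d → suc (a + (b + g) + d) ≡ suc (a + b) + g + d
  exact₄ = solve-∀
  crossₗ : ∀ a g d → suc (g + (a + d)) ≡ suc a + g + d
  crossₗ = solve-∀
  crossᵣ : ∀ a g d → suc (a + g + d) ≡ g + (suc a + d)
  crossᵣ = solve-∀
  exactᵣ : ∀ a b g d → suc (g + (a + (b + d))) ≡ g + (suc (a + b) + d)
  exactᵣ = solve-∀
  slackₗ : ∀ a b g d → suc (a + g + d) + b ≡ suc (a + b) + g + d
  slackₗ = solve-∀
  slackᵣ : ∀ a b g d → suc (g + (a + d)) + b ≡ g + (suc (a + b) + d)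
  slackᵣ = solve-∀

  go : ∀ {s'} → Step ⟨ S ∣ G ⇒ D ⟩ s' → weightₛ s' < weightₛ ⟨ S ∣ G ⇒ D ⟩
  go (∧l {G' = G'} {a = a} {b} p) rewrite Pick-weight p =
    ≤-reflexive (exact₄ (size a) (size b) (weight G') (weight D))
  go (∨l₁ {G' = G'} {a = a} {b} p) rewrite Pick-weight p =
    m+n≤o⇒m≤o _ (≤-reflexive (slackₗ (size a) (size b) (weight G') (weight D)))
  go (∨l₂ {G' = G'} {a = a} {b} p) rewrite Pick-weight p | +-comm (size a) (size b) =
    m+n≤o⇒m≤o _ (≤-reflexive (slackₗ (size b) (size a) (weight G') (weight D)))
  go (¬l {G' = G'} {a = a} p) rewrite Pick-weight p =
    ≤-reflexive (crossₗ (size a) (weight G') (weight D))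
  go (□T {G' = G'} {a = a} p) rewrite Pick-weight p =
    ≤-reflexive (exact₃ (size a) (weight G') (weight D))
  go (∧r₁ {D' = D'} {a = a} {b} p) rewrite Pick-weight p =
    m+n≤o⇒m≤o _ (≤-reflexive (slackᵣ (size a) (size b) (weight G) (weight D')))
  go (∧r₂ {D' = D'} {a = a} {b} p) rewrite Pick-weight p | +-comm (size a) (size b) =
    m+n≤o⇒m≤o _ (≤-reflexive (slackᵣ (size b) (size a) (weight G) (weight D')))
  go (∨r {D' = D'} {a = a} {b} p) rewrite Pick-weight p =
    ≤-reflexive (exactᵣ (size a) (size b) (weight G) (weight D'))
  go (¬r {D' = D'} {a = a} p) rewrite Pick-weight p =
    ≤-reflexive (crossᵣ (size a) (weight G) (weight D'))

module _ {A : Set} (next : A → List A) where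

  reachableWithin : ℕ → A → List A
  reachableWithin zero    x = [ x ]
  reachableWithin (suc n) x = x ∷ concatMap (reachableWithin n) (next x)

  module _ {R : A → A → Set} (R⇒∈next : ∀ {x y} → R x y → y ∈ next x)
           (measure : A → ℕ) (R⇒measure< : ∀ {x y} → R x y → measure y < measure x) where

    Star⇒∈reachableWithin : ∀ n {x y} → measure x ≤ n → Star R x y → y ∈ reachableWithin n x
    Star⇒∈reachableWithin zero    _  ε        = here refl
    Star⇒∈reachableWithin (suc n) _  ε        = here refl
    Star⇒∈reachableWithin zero    le (r ◅ _)  = ⊥-elim (n≮0 (<-≤-trans (R⇒measure< r) le))
    Star⇒∈reachableWithin (suc n) le (r ◅ rs) =
      there (∈-concatMap⁺ (reachableWithin n)
              (lose (R⇒∈next r) (Star⇒∈reachableWithin n (≤-pred (<-≤-trans (R⇒measure< r) le)) rs)))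

reachable : Seq → List Seq
reachable s = reachableWithin invertiblePremises (weightₛ s) s

Star⇒∈reachable : ∀ {s t} → Star Step s t → t ∈ reachable s
Star⇒∈reachable =
  Star⇒∈reachableWithin invertiblePremises Step⇒∈invertiblePremises weightₛ Step⇒weight< _ ≤-refl

infix 4 _∈ₛ_ _≼ₛ_
_∈ₛ_ : Fm → Seq → Set
x ∈ₛ s = x ∈ ant s ⊎ x ∈ succedent s

_≼ₛ_ : Fm → Seq → Set
x ≼ₛ s = ∃[ y ] (y ∈ₛ s × x ≼ y)

∈ₛ⇒≼ₛ : ∀ {x s} → x ∈ₛ s → x ≼ₛ s
∈ₛ⇒≼ₛ m = _ , m , ≼-refl

step-subformula : ∀ {s s' x} → Step s s' → x ∈ₛ s' → x ≼ₛ s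
step-subformula (∧l p)  (inj₁ (here refl))         = _ , inj₁ (Pick⇒∈ p) , ≼-andˡ ≼-refl
step-subformula (∧l p)  (inj₁ (there (here refl))) = _ , inj₁ (Pick⇒∈ p) , ≼-andʳ ≼-refl
step-subformula (∧l p)  (inj₁ (there (there m)))   = _ , inj₁ (Pick⇒⊆ p m) , ≼-refl
step-subformula (∧l p)  (inj₂ m)                   = _ , inj₂ m , ≼-refl
step-subformula (∨l₁ p) (inj₁ (here refl))         = _ , inj₁ (Pick⇒∈ p) , ≼-orˡ ≼-refl
step-subformula (∨l₁ p) (inj₁ (there m))           = _ , inj₁ (Pick⇒⊆ p m) , ≼-refl
step-subformula (∨l₁ p) (inj₂ m)                   = _ , inj₂ m , ≼-refl
step-subformula (∨l₂ p) (inj₁ (here refl))         = _ , inj₁ (Pick⇒∈ p) , ≼-orʳ ≼-refl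
step-subformula (∨l₂ p) (inj₁ (there m))           = _ , inj₁ (Pick⇒⊆ p m) , ≼-refl
step-subformula (∨l₂ p) (inj₂ m)                   = _ , inj₂ m , ≼-refl
step-subformula (¬l p)  (inj₁ m)                   = _ , inj₁ (Pick⇒⊆ p m) , ≼-refl
step-subformula (¬l p)  (inj₂ (here refl))         = _ , inj₁ (Pick⇒∈ p) , ≼-neg ≼-refl
step-subformula (¬l p)  (inj₂ (there m))           = _ , inj₂ m , ≼-refl
step-subformula (□T p)  (inj₁ (here refl))         = _ , inj₁ (Pick⇒∈ p) , ≼-box ≼-refl
step-subformula (□T p)  (inj₁ (there m))           = _ , inj₁ (Pick⇒⊆ p m) , ≼-refl
step-subformula (□T p)  (inj₂ m)                   = _ , inj₂ m , ≼-refl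
step-subformula (∧r₁ p) (inj₁ m)                   = _ , inj₁ m , ≼-refl
step-subformula (∧r₁ p) (inj₂ (here refl))         = _ , inj₂ (Pick⇒∈ p) , ≼-andˡ ≼-refl
step-subformula (∧r₁ p) (inj₂ (there m))           = _ , inj₂ (Pick⇒⊆ p m) , ≼-refl
step-subformula (∧r₂ p) (inj₁ m)                   = _ , inj₁ m , ≼-refl
step-subformula (∧r₂ p) (inj₂ (here refl))         = _ , inj₂ (Pick⇒∈ p) , ≼-andʳ ≼-refl
step-subformula (∧r₂ p) (inj₂ (there m))           = _ , inj₂ (Pick⇒⊆ p m) , ≼-refl
step-subformula (∨r p)  (inj₁ m)                   = _ , inj₁ m , ≼-refl
step-subformula (∨r p)  (inj₂ (here refl))         = _ , inj₂ (Pick⇒∈ p) , ≼-orˡ ≼-refl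
step-subformula (∨r p)  (inj₂ (there (here refl))) = _ , inj₂ (Pick⇒∈ p) , ≼-orʳ ≼-refl
step-subformula (∨r p)  (inj₂ (there (there m)))   = _ , inj₂ (Pick⇒⊆ p m) , ≼-refl
step-subformula (¬r p)  (inj₁ (here refl))         = _ , inj₂ (Pick⇒∈ p) , ≼-neg ≼-refl
step-subformula (¬r p)  (inj₁ (there m))           = _ , inj₁ m , ≼-refl
step-subformula (¬r p)  (inj₂ m)                   = _ , inj₂ (Pick⇒⊆ p m) , ≼-refl

step-≼ₛ : ∀ {s s' x} → Step s s' → x ≼ₛ s' → x ≼ₛ s
step-≼ₛ st (y , y∈ , x≼y) with step-subformula st y∈
... | z , z∈ , y≼z = z , z∈ , ≼-trans x≼y y≼z

star-≼ₛ : ∀ {s t x} → Star Step s t → x ≼ₛ t → x ≼ₛ s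
star-≼ₛ ε        h = h
star-≼ₛ (st ◅ r) h = step-≼ₛ st (star-≼ₛ r h)

boxed-step : ∀ {s s'} → Step s s' →
             boxed s' ≡ boxed s ⊎ ∃[ a ] (box a ∈ ant s × boxed s' ≡ a ∷ boxed s)
boxed-step (∧l _)  = inj₁ refl
boxed-step (∨l₁ _) = inj₁ refl
boxed-step (∨l₂ _) = inj₁ refl
boxed-step (¬l _)  = inj₁ refl
boxed-step (□T p)  = inj₂ (_ , Pick⇒∈ p , refl)
boxed-step (∧r₁ _) = inj₁ refl
boxed-step (∧r₂ _) = inj₁ refl
boxed-step (∨r _)  = inj₁ refl
boxed-step (¬r _)  = inj₁ refl

step-boxed-⊆ : ∀ {s s'} → Step s s' → boxed s ⊆ boxed s'
step-boxed-⊆ st m with boxed-step st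
... | inj₁ eq           rewrite eq = m
... | inj₂ (_ , _ , eq) rewrite eq = there m

step-boxed-subformula : ∀ {s s' x} → Step s s' → x ∈ boxed s' → x ∈ boxed s ⊎ x ≼ₛ s
step-boxed-subformula st m with boxed-step st
... | inj₁ eq rewrite eq = inj₁ m
... | inj₂ (_ , □a∈ , eq) rewrite eq with m
...   | here refl = inj₂ (_ , inj₁ □a∈ , ≼-box ≼-refl)
...   | there m'  = inj₁ m'

star-boxed-⊆ : ∀ {s t} → Star Step s t → boxed s ⊆ boxed t
star-boxed-⊆ ε        m = m
star-boxed-⊆ (st ◅ r) m = star-boxed-⊆ r (step-boxed-⊆ st m)

star-boxed-subformula : ∀ {s t x} → Star Step s t → x ∈ boxed t → x ∈ boxed s ⊎ x ≼ₛ s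
star-boxed-subformula ε        m = inj₁ m
star-boxed-subformula (st ◅ r) m with star-boxed-subformula r m
... | inj₁ m' = step-boxed-subformula st m'
... | inj₂ h  = inj₂ (step-≼ₛ st h)

premiseCandidates : List Fm → Fm → List Seq
premiseCandidates S (box a) = ⟨ S ∣ [] ⇒ [ a ] ⟩ ∷ ⟨ Dbody a ∷ S ∣ S ⇒ [ a ] ⟩ ∷ []
premiseCandidates S _       = []

modalPremises : Seq → List Seq
modalPremises s = concatMap (premiseCandidates (boxed s)) (succedent s)

ModalPremise⇒∈modalPremises : ∀ {s a s'} → box a ∈ succedent s → ModalPremise (boxed s) a s' →
                              s' ∈ modalPremises s
ModalPremise⇒∈modalPremises {s} m (grz1 _) =
  ∈-concatMap⁺ (premiseCandidates (boxed s)) (lose m (here refl))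
ModalPremise⇒∈modalPremises {s} m (grz2 _) =
  ∈-concatMap⁺ (premiseCandidates (boxed s)) (lose m (there (here refl)))

subtree : ∀ {s s'} → FinTree s → Child s s' → FinTree s'
subtree (node _ _ kids) = kids _

finTree-critical : ∀ {s} → Critical s →
                   (∀ {a s'} → box a ∈ succedent s → ModalPremise (boxed s) a s' → FinTree s') →
                   FinTree s
finTree-critical {s} c premise = node (modalPremises s) cover kids
  where
  cover : ∀ s' → Child s s' → s' ∈ modalPremises s
  cover _ (inj₁ (nc , _))              = ⊥-elim (nc c)
  cover _ (inj₂ (_ , _ , _ , m , mp)) = ModalPremise⇒∈modalPremises {s} m mp
  kids : ∀ s' → Child s s' → FinTree s'
  kids _ (inj₁ (nc , _))              = ⊥-elim (nc c)
  kids _ (inj₂ (_ , _ , _ , m , mp)) = premise m mp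

-- The modal children of a critical node are covered as well: it lies in its own closure.
finTree-closure : ∀ {s} → (∀ {t} → InClosure s t → FinTree t) → FinTree s
finTree-closure {s} closure = node (reachable s ++ modalPremises s) cover kids
  where
  cover : ∀ s' → Child s s' → s' ∈ reachable s ++ modalPremises s
  cover _ (inj₁ (_ , r , _))           = ∈-++⁺ˡ (Star⇒∈reachable r)
  cover _ (inj₂ (_ , _ , _ , m , mp)) = ∈-++⁺ʳ (reachable s) (ModalPremise⇒∈modalPremises {s} m mp)
  kids : ∀ s' → Child s s' → FinTree s'
  kids _ (inj₁ (_ , cl))         = closure cl
  kids _ (inj₂ child@(c , _))    = subtree (closure (ε , c)) (inj₂ child)

module _ {A : Set} (_≟ₐ_ : DecidableEquality A) where
  open import Data.List.Membership.DecPropositional _≟ₐ_ using (_∈?_)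

  missing : List A → List A → ℕ
  missing S []      = 0
  missing S (u ∷ U) with u ∈? S
  ... | yes _ = missing S U
  ... | no  _ = suc (missing S U)

  missing-antitone : ∀ {S S'} → S ⊆ S' → ∀ U → missing S' U ≤ missing S U
  missing-antitone         S⊆S' []      = z≤n
  missing-antitone {S} {S'} S⊆S' (u ∷ U) with u ∈? S | u ∈? S'
  ... | yes _   | yes _    = missing-antitone S⊆S' U
  ... | yes u∈S | no  u∉S' = ⊥-elim (u∉S' (S⊆S' u∈S))
  ... | no  _   | yes _    = m≤n⇒m≤1+n (missing-antitone S⊆S' U)
  ... | no  _   | no  _    = s≤s (missing-antitone S⊆S' U)

  missing-strict : ∀ {S S' x} → S ⊆ S' → x ∉ S → x ∈ S' →
                   ∀ {U} → x ∈ U → missing S' U < missing S U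
  missing-strict {S} {S'} S⊆S' x∉S x∈S' {u ∷ U} (here refl) with u ∈? S | u ∈? S'
  ... | yes u∈S | _        = ⊥-elim (x∉S u∈S)
  ... | no  _   | yes _    = s≤s (missing-antitone S⊆S' U)
  ... | no  _   | no  u∉S' = ⊥-elim (u∉S' x∈S')
  missing-strict {S} {S'} S⊆S' x∉S x∈S' {u ∷ U} (there x∈U) with u ∈? S | u ∈? S'
  ... | yes _   | yes _    = missing-strict S⊆S' x∉S x∈S' x∈U
  ... | yes u∈S | no  u∉S' = ⊥-elim (u∉S' (S⊆S' u∈S))
  ... | no  _   | yes _    = m≤n⇒m≤1+n (missing-strict S⊆S' x∉S x∈S' x∈U)
  ... | no  _   | no  _    = s≤s (missing-strict S⊆S' x∉S x∈S' x∈U)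

boxSize : Fm → ℕ
boxSize (box a) = size a
boxSize _       = 0

maxBoxSize : List Fm → ℕ
maxBoxSize []      = 0
maxBoxSize (x ∷ L) = boxSize x ⊔ maxBoxSize L

size≤maxBoxSize : ∀ {a L} → box a ∈ L → size a ≤ maxBoxSize L
size≤maxBoxSize {a} {_ ∷ L} (here refl) = m≤m⊔n (size a) (maxBoxSize L)
size≤maxBoxSize {L = x ∷ L} (there m)   = ≤-trans (size≤maxBoxSize m) (m≤n⊔m (boxSize x) (maxBoxSize L))

0<size : ∀ a → 0 < size a
0<size (var _)   = s≤s z≤n
0<size bot       = s≤s z≤n
0<size (neg _)   = s≤s z≤n
0<size (_ and _) = s≤s z≤n
0<size (_ or _)  = s≤s z≤n
0<size (box _)   = s≤s z≤n

≼⇒boxSize< : ∀ {x a} → x ≼ a → boxSize x < size a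
≼⇒boxSize< {box _}   p = ≼⇒size≤ p
≼⇒boxSize< {var _}   {a} _ = 0<size a
≼⇒boxSize< {bot}     {a} _ = 0<size a
≼⇒boxSize< {neg _}   {a} _ = 0<size a
≼⇒boxSize< {_ and _} {a} _ = 0<size a
≼⇒boxSize< {_ or _}  {a} _ = 0<size a

maxBoxSize<size : ∀ {a} L → (∀ {x} → x ∈ L → x ≼ a) → maxBoxSize L < size a
maxBoxSize<size {a} []      _  = 0<size a
maxBoxSize<size     (x ∷ L) ≼a =
  ⊔-lub (≼⇒boxSize< (≼a (here refl))) (maxBoxSize<size L (≼a ∘ there))

infix 4 _<ₗₑₓ_
_<ₗₑₓ_ : ℕ × ℕ → ℕ × ℕ → Set
_<ₗₑₓ_ = ×-Lex _≡_ _<_ _<_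

≤×<⇒<ₗₑₓ : ∀ {m m' n n'} → m' ≤ m → n' < n → (m' , n') <ₗₑₓ (m , n)
≤×<⇒<ₗₑₓ m'≤m n'<n with m≤n⇒m<n∨m≡n m'≤m
... | inj₁ m'<m = inj₁ m'<m
... | inj₂ m'≡m = inj₂ (m'≡m , n'<n)

module Universe (Φ : List Fm) where

  Relevant : Fm → Set
  Relevant x = x ≼ₗ Φ ⊎ ∃[ b ] (b ≼ₗ Φ × x ≼ Dbody b)

  universe : List Fm
  universe = concatMap subformulas Φ ++ concatMap (subformulas ∘ Dbody) (concatMap subformulas Φ)

  Relevant⇒∈universe : ∀ {x} → Relevant x → x ∈ universe
  Relevant⇒∈universe (inj₁ x≼Φ) = ∈-++⁺ˡ (≼ₗ⇒∈ x≼Φ)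
  Relevant⇒∈universe (inj₂ (b , b≼Φ , x≼Db)) =
    ∈-++⁺ʳ (concatMap subformulas Φ)
      (∈-concatMap⁺ (subformulas ∘ Dbody) (lose (≼ₗ⇒∈ b≼Φ) (≼⇒∈subformulas x≼Db)))

  Relevant-≼ : ∀ {x y} → x ≼ y → Relevant y → Relevant x
  Relevant-≼ x≼y (inj₁ (z , z∈ , y≼z))   = inj₁ (z , z∈ , ≼-trans x≼y y≼z)
  Relevant-≼ x≼y (inj₂ (b , b≼Φ , y≼Db)) = inj₂ (b , b≼Φ , ≼-trans x≼y y≼Db)

  Relevant-Dbody : ∀ {a} → Relevant (box a) → Relevant (Dbody a)
  Relevant-Dbody (inj₁ (z , z∈ , □a≼z)) =
    inj₂ (_ , (z , z∈ , ≼-trans (≼-box ≼-refl) □a≼z) , ≼-refl)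
  Relevant-Dbody (inj₂ (b , (z , z∈ , b≼z) , □a≼Db)) =
    inj₂ (_ , (z , z∈ , ≼-trans (box-≼-Dbody □a≼Db) b≼z) , ≼-refl)

  RelevantSeq : Seq → Set
  RelevantSeq s = (∀ {x} → x ∈ boxed s → Relevant x) × (∀ {x} → x ∈ₛ s → Relevant x)

  star-RelevantSeq : ∀ {s t} → Star Step s t → RelevantSeq s → RelevantSeq t
  star-RelevantSeq {s} {t} r (relevantBoxed , relevant) = relevantBoxed' , relevant'
    where
    relevant-≼ₛ : ∀ {x} → x ≼ₛ s → Relevant x
    relevant-≼ₛ (_ , y∈ , x≼y) = Relevant-≼ x≼y (relevant y∈)
    relevantBoxed' : ∀ {x} → x ∈ boxed t → Relevant x
    relevantBoxed' m with star-boxed-subformula r m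
    ... | inj₁ m' = relevantBoxed m'
    ... | inj₂ h  = relevant-≼ₛ h
    relevant' : ∀ {x} → x ∈ₛ t → Relevant x
    relevant' = relevant-≼ₛ ∘ star-≼ₛ r ∘ ∈ₛ⇒≼ₛ {s = t}

  premise-RelevantSeq : ∀ {s a s'} → RelevantSeq s → box a ∈ succedent s →
                        ModalPremise (boxed s) a s' → RelevantSeq s'
  premise-RelevantSeq (relevantBoxed , relevant) □a∈ (grz1 _) =
    relevantBoxed , λ { (inj₂ (here refl)) → Relevant-≼ (≼-box ≼-refl) (relevant (inj₂ □a∈)) }
  premise-RelevantSeq (relevantBoxed , relevant) □a∈ (grz2 _) =
    (λ { (here refl) → Relevant-Dbody (relevant (inj₂ □a∈)) ; (there m) → relevantBoxed m }) ,
    (λ { (inj₁ m)            → relevantBoxed m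
       ; (inj₂ (here refl)) → Relevant-≼ (≼-box ≼-refl) (relevant (inj₂ □a∈)) })

  measure : Seq → ℕ × ℕ
  measure s = missing _≟_ (boxed s) universe , maxBoxSize (succedent s)

  _⊏_ : Seq → Seq → Set
  _⊏_ = _<ₗₑₓ_ on measure

  ⊏-wellFounded : WellFounded _⊏_
  ⊏-wellFounded = On.wellFounded measure (×-wellFounded <-wellFounded <-wellFounded)

  modal-descent : ∀ {s a s₁ t} → RelevantSeq s → box a ∈ succedent s → ModalPremise (boxed s) a s₁ →
                  Star Step s₁ t → t ⊏ s
  modal-descent {s} {a} {t = t} _ □a∈ (grz1 _) r =
    ≤×<⇒<ₗₑₓ (missing-antitone _≟_ (star-boxed-⊆ r) universe)
             (<-≤-trans (maxBoxSize<size (succedent t) (below-a ∘ star-≼ₛ r ∘ ∈ₛ⇒≼ₛ {s = t} ∘ inj₂))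
                        (size≤maxBoxSize □a∈))
    where
    below-a : ∀ {x} → x ≼ₛ ⟨ boxed s ∣ [] ⇒ [ a ] ⟩ → x ≼ a
    below-a (_ , inj₂ (here refl) , x≼a) = x≼a
  modal-descent (_ , relevant) □a∈ (grz2 Da∉) r =
    inj₁ (missing-strict _≟_ (star-boxed-⊆ r ∘ there) Da∉ (star-boxed-⊆ r (here refl))
                         (Relevant⇒∈universe (Relevant-Dbody (relevant (inj₂ □a∈)))))

  finTree-relevant-critical : ∀ {t} → Acc _⊏_ t → RelevantSeq t → Critical t → FinTree t
  finTree-relevant-critical (acc rec) relevant c = finTree-critical c λ □a∈ mp →
    finTree-closure λ (r , c') →
      finTree-relevant-critical (rec (modal-descent relevant □a∈ mp r))
                                (star-RelevantSeq r (premise-RelevantSeq relevant □a∈ mp)) c'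

lemma2p13 : (Φ Ψ : List Fm) → FinTree ⟨ [] ∣ Φ ⇒ Ψ ⟩
lemma2p13 Φ Ψ = finTree-closure λ {t} (r , c) →
  finTree-relevant-critical (⊏-wellFounded t) (star-RelevantSeq r root-relevant) c
  where
  open Universe (Φ ++ Ψ)
  root-relevant : RelevantSeq ⟨ [] ∣ Φ ⇒ Ψ ⟩
  root-relevant = (λ ()) , λ { (inj₁ m) → inj₁ (_ , ∈-++⁺ˡ m , ≼-refl)
                             ; (inj₂ m) → inj₁ (_ , ∈-++⁺ʳ Φ m , ≼-refl) }
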